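{- Let $X=\{x_1,\dots,x_m\}$ be a finite domain, $\mathcal F$ a set of boolean functions $X\to\{0,1\}$, and $\mathcal F_\vee=\{\bigvee_{f\in S}f\mid S\subseteq\mathcal F\}$. For every $G\in\mathcal F_\vee$, $${\rm TD}(\mathcal F_\vee,G)\ge|{\rm De}(G)|+{\rm HS}({\rm As}(G)\wedge\bar G).$$ In particular, $${\rm ETD}(\mathcal F_\vee)={\rm TD}(\mathcal F_\vee)=\max_{G\in G(\mathcal F_\vee)}\left(|{\rm De}(G)|+{\rm HS}({\rm As}(G)\wedge\bar G)\right).$$
   Context: $G(\mathcal F_\vee)$ is a set of representatives of the distinct functions computed by members of $\mathcal F_\vee$, partially ordered by logical implication ($G_1\Rightarrow G_2$ iff $G_1\le G_2$ pointwise); ${\rm De}(G)$ and ${\rm As}(G)$ are the sets of immediate descendants and immediate ascendants of $G$ in the Hasse diagram of this order. ${\rm As}(G)\wedge\bar G=\{s\wedge\bar G\mid s\in{\rm As}(G)\}$. For a set $D$ of functions $X\to\{0,1\}$, ${\rm HS}(D)$ is the minimum size of $W\subseteq X$ such that every non-zero $g\in D$ has $g(x)=1$ for some $x\in W$. For a class $C$ of functions and $G\in C$, a witness set for $G$ in $C$ is $W\subseteq X$ such that for every $G'\in C$ with $G'\ne G$ (as functions) there is $a\in W$ with $G(a)\ne G'(a)$; ${\rm TD}(C,G)$ is the minimum size of a witness set and ${\rm TD}(C)=\max_{G\in C}{\rm TD}(C,G)$. For $h:X\to\{0,1\}$, a specifying set for $h$ with respect to $C$ is $S\subseteq X$ such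 that at most one function in $C$ agrees with $h$ on $S$; ${\rm ETD}(C,h)$ is its minimum size and ${\rm ETD}(C)=\max_h{\rm ETD}(C,h)$. -}

module Defs where

open import Data.Bool using (Bool; true; false; _∧_; _∨_; not)
open import Data.Nat using (ℕ; _≤_; _+_)
open import Data.Fin using (Fin; zero; suc)
open import Data.Fin.Subset using (Subset; _∈_; ∣_∣)
open import Data.Vec using (Vec; []; _∷_)
open import Data.Product using (Σ; _×_; _,_)
open import Relation.Binary.PropositionalEquality using (_≡_; _≗_)
open import Relation.Nullary using (¬_)
open import Function using (_∘_)

Fun : ℕ → Set
Fun m = Fin m → Bool

Class : ℕ → Set₁
Class m = Fun m → Set

bigOr : ∀ {m k} → (Fin k → Fun m) → Subset k → Fun m
bigOr fs []      x = false
bigOr fs (b ∷ S) x = (b ∧ fs zero x) ∨ bigOr (fs ∘ suc) S x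

-- F_∨ = { ⋁_{f ∈ S} f | S ⊆ F }, with F given as the family fs.
OrClosure : ∀ {m k} → (Fin k → Fun m) → Class m
OrClosure {m} {k} fs G = Σ (Subset k) λ S → G ≗ bigOr fs S

_⇒ᶠ_ : ∀ {m} → Fun m → Fun m → Set
g ⇒ᶠ h = ∀ x → g x ≡ true → h x ≡ true

_<ᶠ_ : ∀ {m} → Fun m → Fun m → Set
g <ᶠ h = (g ⇒ᶠ h) × ¬ (g ≗ h)

ImmDesc : ∀ {m} → Class m → Fun m → Class m
ImmDesc {m} C G H = C H × (H <ᶠ G) × ¬ (Σ (Fun m) λ K → C K × (H <ᶠ K) × (K <ᶠ G))

ImmAsc : ∀ {m} → Class m → Fun m → Class m
ImmAsc {m} C G H = C H × (G <ᶠ H) × ¬ (Σ (Fun m) λ K → C K × (G <ᶠ K) × (K <ᶠ H))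

HasSize : ∀ {m} → Class m → ℕ → Set
HasSize {m} P n =
  Σ (Fin n → Fun m) λ v →
    (∀ i → P (v i)) ×
    (∀ i j → v i ≗ v j → i ≡ j) ×
    (∀ g → P g → Σ (Fin n) λ i → g ≗ v i)

AscAndNotG : ∀ {m} → Class m → Fun m → Class m
AscAndNotG {m} C G g = Σ (Fun m) λ s → ImmAsc C G s × (g ≗ λ x → s x ∧ not (G x))

IsMinSize : ∀ {m} → (Subset m → Set) → ℕ → Set
IsMinSize {m} P n = (Σ (Subset m) λ W → P W × ∣ W ∣ ≡ n) × (∀ W → P W → n ≤ ∣ W ∣)

IsHittingSet : ∀ {m} → Class m → Subset m → Set
IsHittingSet {m} D W =
  ∀ g → D g → (Σ (Fin m) λ x → g x ≡ true) → Σ (Fin m) λ x → x ∈ W × g x ≡ true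

HS : ∀ {m} → Class m → ℕ → Set
HS D n = IsMinSize (IsHittingSet D) n

IsWitnessSet : ∀ {m} → Class m → Fun m → Subset m → Set
IsWitnessSet {m} C G W =
  ∀ G′ → C G′ → ¬ (G ≗ G′) → Σ (Fin m) λ a → a ∈ W × ¬ (G a ≡ G′ a)

TDat : ∀ {m} → Class m → Fun m → ℕ → Set
TDat C G n = IsMinSize (IsWitnessSet C G) n

TD : ∀ {m} → Class m → ℕ → Set
TD {m} C n =
  (Σ (Fun m) λ G → C G × TDat C G n) ×
  (∀ G k → C G → TDat C G k → k ≤ n)

IsSpecifyingSet : ∀ {m} → Class m → Fun m → Subset m → Set
IsSpecifyingSet C h S =
  ∀ g₁ g₂ → C g₁ → C g₂ →
    (∀ x → x ∈ S → g₁ x ≡ h x) → (∀ x → x ∈ S → g₂ x ≡ h x) → g₁ ≗ g₂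

ETDat : ∀ {m} → Class m → Fun m → ℕ → Set
ETDat C h n = IsMinSize (IsSpecifyingSet C h) n

ETD : ∀ {m} → Class m → ℕ → Set
ETD {m} C n =
  (Σ (Fun m) λ h → ETDat C h n) ×
  (∀ h k → ETDat C h k → k ≤ n)

DeHSValue : ∀ {m} → Class m → Fun m → ℕ → Set
DeHSValue C G n =
  Σ ℕ λ d → Σ ℕ λ h → HasSize (ImmDesc C G) d × HS (AscAndNotG C G) h × d + h ≡ n

MaxDeHS : ∀ {m} → Class m → ℕ → Set
MaxDeHS {m} C n =
  (Σ (Fun m) λ G → C G × DeHSValue C G n) ×
  (∀ G k → C G → DeHSValue C G k → k ≤ n)

-- A witness set W for G ∈ F∨ must separate G from each immediate descendant D, at a point where
-- G = 1 and D = 0; distinct immediate descendants D₁, D₂ satisfy D₁ ∨ D₂ = G, so these points are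
-- pairwise distinct.  It must also separate G from each immediate ascendant s, at a point where
-- s ∧ Ḡ = 1, so W ∩ {G = 0} hits As(G) ∧ Ḡ.  Hence TD(F∨, G) ≥ |De(G)| + HS(As(G) ∧ Ḡ).
-- Conversely, one such point per descendant together with a minimum hitting set singles G out: a
-- G′ ∈ F∨ strictly below G lies below an immediate descendant, and if G′ ⇏ G then G ∨ G′ ∈ F∨ lies
-- above an immediate ascendant.  The same construction for a minimal M ∈ F∨ above h ∧ ⋁F specifies
-- an arbitrary h, so ETD(F∨) = TD(F∨) = max_G (|De(G)| + HS(As(G) ∧ Ḡ)).

module Submission where

open import Defs
open import Data.Bool using (true; false; _∧_; _∨_; not)
open import Data.Bool.Properties using (∧-distribʳ-∨; ∨-zeroʳ; ∧-conicalˡ; ∧-conicalʳ; not-injective; ∨-commutativeMonoid) renaming (_≟_ to _≟ᵇ_)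
open import Data.Nat using (ℕ; zero; suc; _≤_; _<_; _+_; _∸_; _≟_; z≤n; s≤s)
open import Data.Nat.Properties hiding (0≢1+n; suc-injective)
open import Data.Nat.Induction using (<-wellFounded)
open import Data.Fin using (Fin; zero; suc)
open import Data.Fin.Properties using (any?; all?; ¬∀⟶∃¬; suc-injective; 0≢1+n)
open import Data.Fin.Subset using (Subset; _∈_; ∣_∣; _∪_; _∩_; ∁; ⁅_⁆; _-_; ⊤; ⊥)
open import Data.Fin.Subset.Properties
open import Data.Product using (Σ; ∃; _×_; _,_; proj₁; proj₂)
open import Data.Sum using (inj₁; inj₂)
open import Data.Vec using ([]; _∷_; tabulate)
open import Data.Vec.Properties using (lookup∘tabulate; []=⇒lookup; lookup⇒[]=; tabulate-cong)
open import Data.List as List using (List; _++_)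
open import Data.List.Relation.Unary.Any as Any using (Any; here)
open import Data.List.Membership.Propositional using () renaming (_∈_ to _∈ˡ_)
open import Data.List.Membership.Propositional.Properties using (∈-map⁺; ∈-++⁺ˡ; ∈-++⁺ʳ)
import Data.Vec.Functional as Vector
open import Algebra.Bundles using (CommutativeMonoid)
open import Algebra.Properties.CommutativeSemigroup (CommutativeMonoid.commutativeSemigroup ∨-commutativeMonoid) using (interchange)
open import Function using (_∘_)
open import Function.Definitions using (Injective)
open import Induction.WellFounded using (Acc; acc)
open import Relation.Binary.PropositionalEquality
  using (_≡_; _≢_; _≗_; refl; sym; trans; cong; cong₂; subst; module ≡-Reasoning)
open import Relation.Nullary using (¬_; Dec; yes; no; contradiction)
open import Relation.Nullary.Decidable using (_×-dec_; _→-dec_; ¬?; decidable-stable)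
open import Relation.Unary using (Pred; Decidable; U)
open import Relation.Unary.Properties using (U?)

-- Minimisation over finite search spaces

module _ {p} {Q : Pred ℕ p} (Q? : Decidable Q) where

  least : ∀ {n} → Q n → ∃ λ k → Q k × (∀ {j} → Q j → k ≤ j)
  least {n} = go (<-wellFounded n)
    where
    go : ∀ {n} → Acc _<_ n → Q n → ∃ λ k → Q k × (∀ {j} → Q j → k ≤ j)
    go {n} (acc smaller) qn with anyUpTo? Q? n
    ... | yes (j , j<n , qj) = go (smaller j<n) qj
    ... | no ∄ = n , qn , λ {j} qj → ≮⇒≥ λ j<n → ∄ (j , j<n , qj)

module _ {n p} {P : Pred (Subset n) p} (P? : Decidable P) where

  argmin : (f : Subset n → ℕ) → ∃ P → ∃ λ S → P S × (∀ {T} → P T → f S ≤ f T)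
  argmin f (S₀ , pS₀) with least (λ j → anySubset? λ S → P? S ×-dec (f S ≟ j)) (S₀ , pS₀ , refl)
  ... | _ , (S , pS , refl) , minimal = S , pS , λ pT → minimal (_ , pT , refl)

  -- Maximising f is minimising b ∸ f, which reverses the order because f ≤ b.
  argmax : (f : Subset n → ℕ) {b : ℕ} → (∀ S → f S ≤ b) → ∃ P →
           ∃ λ S → P S × (∀ {T} → P T → f T ≤ f S)
  argmax f {b} bounded ∃P with argmin (λ S → b ∸ f S) ∃P
  ... | S , pS , minimal = S , pS , λ {T} pT → ∸-cancelʳ-≤ (bounded T) (minimal pT)

IsMinSize-unique : ∀ {m} {P : Subset m → Set} {n k} → IsMinSize P n → IsMinSize P k → n ≡ k
IsMinSize-unique ((W , pW , refl) , minₙ) ((V , pV , refl) , minₖ) = ≤-antisym (minₙ V pV) (minₖ W pW)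

IsMinSize-cong : ∀ {m} {P P′ : Subset m → Set} {n} → (∀ {W} → P W → P′ W) → (∀ {W} → P′ W → P W) →
                 IsMinSize P n → IsMinSize P′ n
IsMinSize-cong to from ((W , pW , size) , minimal) = (W , to pW , size) , λ V p′V → minimal V (from p′V)

minSize : ∀ {m} {P : Subset m → Set} → Decidable P → ∃ P → ∃ (IsMinSize P)
minSize P? ∃P with argmin P? ∣_∣ ∃P
... | W , pW , minimal = ∣ W ∣ , (W , pW , refl) , λ V pV → minimal pV

∣p∪q∣≤∣p∣+∣q∣ : ∀ {n} (p q : Subset n) → ∣ p ∪ q ∣ ≤ ∣ p ∣ + ∣ q ∣
∣p∪q∣≤∣p∣+∣q∣ []          []          = z≤n
∣p∪q∣≤∣p∣+∣q∣ (true ∷ p)  (true ∷ q)  = s≤s (≤-trans (∣p∪q∣≤∣p∣+∣q∣ p q) (+-monoʳ-≤ ∣ p ∣ (n≤1+n ∣ q ∣)))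
∣p∪q∣≤∣p∣+∣q∣ (true ∷ p)  (false ∷ q) = s≤s (∣p∪q∣≤∣p∣+∣q∣ p q)
∣p∪q∣≤∣p∣+∣q∣ (false ∷ p) (true ∷ q)  = subst (suc ∣ p ∪ q ∣ ≤_) (sym (+-suc ∣ p ∣ ∣ q ∣)) (s≤s (∣p∪q∣≤∣p∣+∣q∣ p q))
∣p∪q∣≤∣p∣+∣q∣ (false ∷ p) (false ∷ q) = ∣p∪q∣≤∣p∣+∣q∣ p q

∣p∩q∣+∣p∩∁q∣≡∣p∣ : ∀ {n} (p q : Subset n) → ∣ p ∩ q ∣ + ∣ p ∩ ∁ q ∣ ≡ ∣ p ∣
∣p∩q∣+∣p∩∁q∣≡∣p∣ []          []          = refl
∣p∩q∣+∣p∩∁q∣≡∣p∣ (true ∷ p)  (true ∷ q)  = cong suc (∣p∩q∣+∣p∩∁q∣≡∣p∣ p q)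
∣p∩q∣+∣p∩∁q∣≡∣p∣ (true ∷ p)  (false ∷ q) = trans (+-suc ∣ p ∩ q ∣ ∣ p ∩ ∁ q ∣) (cong suc (∣p∩q∣+∣p∩∁q∣≡∣p∣ p q))
∣p∩q∣+∣p∩∁q∣≡∣p∣ (false ∷ p) (true ∷ q)  = ∣p∩q∣+∣p∩∁q∣≡∣p∣ p q
∣p∩q∣+∣p∩∁q∣≡∣p∣ (false ∷ p) (false ∷ q) = ∣p∩q∣+∣p∩∁q∣≡∣p∣ p q

injective⇒≤∣p∣ : ∀ {n d} (p : Subset n) (a : Fin d → Fin n) → (∀ i → a i ∈ p) → Injective _≡_ _≡_ a → d ≤ ∣ p ∣
injective⇒≤∣p∣ {d = zero}  p a a∈p injective = z≤n
injective⇒≤∣p∣ {d = suc d} p a a∈p injective =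
  ≤-trans (s≤s (injective⇒≤∣p∣ (p - a zero) (a ∘ suc) a∈p-a₀ (suc-injective ∘ injective)))
          (x∈p⇒∣p-x∣<∣p∣ (a∈p zero))
  where
  a∈p-a₀ : ∀ i → a (suc i) ∈ p - a zero
  a∈p-a₀ i = x∈p∧x≢y⇒x∈p-y (a∈p (suc i)) (0≢1+n ∘ sym ∘ injective)

image : ∀ {n d} → (Fin d → Fin n) → Subset n
image {d = zero}  a = ⊥
image {d = suc d} a = ⁅ a zero ⁆ ∪ image (a ∘ suc)

a∈image : ∀ {n d} (a : Fin d → Fin n) i → a i ∈ image a
a∈image a zero    = x∈p∪q⁺ (inj₁ (x∈⁅x⁆ (a zero)))
a∈image a (suc i) = x∈p∪q⁺ (inj₂ (a∈image (a ∘ suc) i))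

∣image∣≤ : ∀ {n d} (a : Fin d → Fin n) → ∣ image a ∣ ≤ d
∣image∣≤ {n} {zero}  a = ≤-reflexive (∣⊥∣≡0 n)
∣image∣≤ {d = suc d} a = begin
  ∣ ⁅ a zero ⁆ ∪ image (a ∘ suc) ∣      ≤⟨ ∣p∪q∣≤∣p∣+∣q∣ ⁅ a zero ⁆ (image (a ∘ suc)) ⟩
  ∣ ⁅ a zero ⁆ ∣ + ∣ image (a ∘ suc) ∣  ≡⟨ cong (_+ ∣ image (a ∘ suc) ∣) (∣⁅x⁆∣≡1 (a zero)) ⟩
  suc ∣ image (a ∘ suc) ∣               ≤⟨ s≤s (∣image∣≤ (a ∘ suc)) ⟩
  suc d                                 ∎
  where open ≤-Reasoning

-- Boolean functions ordered by implication

module _ {m : ℕ} where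

  ≗-sym : {f g : Fun m} → f ≗ g → g ≗ f
  ≗-sym f≗g x = sym (f≗g x)

  ≗-trans : {f g h : Fun m} → f ≗ g → g ≗ h → f ≗ h
  ≗-trans f≗g g≗h x = trans (f≗g x) (g≗h x)

  _≗?_ : (f g : Fun m) → Dec (f ≗ g)
  f ≗? g = all? λ x → f x ≟ᵇ g x

  _⇒ᶠ?_ : (f g : Fun m) → Dec (f ⇒ᶠ g)
  f ⇒ᶠ? g = all? λ x → (f x ≟ᵇ true) →-dec (g x ≟ᵇ true)

  _<ᶠ?_ : (f g : Fun m) → Dec (f <ᶠ g)
  f <ᶠ? g = (f ⇒ᶠ? g) ×-dec ¬? (f ≗? g)

  ⇒ᶠ-trans : {f g h : Fun m} → f ⇒ᶠ g → g ⇒ᶠ h → f ⇒ᶠ h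
  ⇒ᶠ-trans f⇒g g⇒h x fx = g⇒h x (f⇒g x fx)

  ⇒ᶠ-antisym : {f g : Fun m} → f ⇒ᶠ g → g ⇒ᶠ f → f ≗ g
  ⇒ᶠ-antisym {f} {g} f⇒g g⇒f x with f x in fx | g x in gx
  ... | true  | true  = refl
  ... | false | false = refl
  ... | true  | false = contradiction (trans (sym gx) (f⇒g x fx)) λ ()
  ... | false | true  = contradiction (trans (sym fx) (g⇒f x gx)) λ ()

  ⇒ᶠ-resp-≗ : {f f′ g g′ : Fun m} → f ≗ f′ → g ≗ g′ → f ⇒ᶠ g → f′ ⇒ᶠ g′
  ⇒ᶠ-resp-≗ f≗f′ g≗g′ f⇒g x f′x = trans (sym (g≗g′ x)) (f⇒g x (trans (f≗f′ x) f′x))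

  <ᶠ-resp-≗ : {f f′ g g′ : Fun m} → f ≗ f′ → g ≗ g′ → f <ᶠ g → f′ <ᶠ g′
  <ᶠ-resp-≗ f≗f′ g≗g′ (f⇒g , f≉g) =
    ⇒ᶠ-resp-≗ f≗f′ g≗g′ f⇒g , λ f′≗g′ → f≉g (≗-trans f≗f′ (≗-trans f′≗g′ (≗-sym g≗g′)))

  ⇒ᶠ-separates : {f g : Fun m} → f ⇒ᶠ g → ∀ {x} → f x ≢ g x → f x ≡ false × g x ≡ true
  ⇒ᶠ-separates {f} {g} f⇒g {x} fx≢gx with f x in fx | g x in gx
  ... | false | true  = refl , refl
  ... | false | false = contradiction refl fx≢gx
  ... | true  | true  = contradiction refl fx≢gx
  ... | true  | false = contradiction (trans (sym gx) (f⇒g x fx)) λ ()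

  ≉⇒∃≢ : {f g : Fun m} → ¬ f ≗ g → ∃ λ x → f x ≢ g x
  ≉⇒∃≢ {f} {g} = ¬∀⟶∃¬ m _ λ x → f x ≟ᵇ g x

  <ᶠ⇒∃-gap : {f g : Fun m} → f <ᶠ g → ∃ λ x → f x ≡ false × g x ≡ true
  <ᶠ⇒∃-gap (f⇒g , f≉g) with ≉⇒∃≢ f≉g
  ... | x , fx≢gx = x , ⇒ᶠ-separates f⇒g fx≢gx

  ⇏ᶠ⇒∃-gap : {f g : Fun m} → ¬ f ⇒ᶠ g → ∃ λ x → f x ≡ true × g x ≡ false
  ⇏ᶠ⇒∃-gap {f} {g} f⇏g with ¬∀⟶∃¬ m _ (λ x → (f x ≟ᵇ true) →-dec (g x ≟ᵇ true)) (λ f⇒g → f⇏g λ x → f⇒g x)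
  ... | x , ¬fx⇒gx with f x in fx | g x in gx
  ... | true  | false = x , fx , gx
  ... | true  | true  = contradiction (λ _ → refl) ¬fx⇒gx
  ... | false | _     = contradiction (λ ()) ¬fx⇒gx

  infixl 30 _∨ᶠ_ _∧ᶠ_

  _∨ᶠ_ : Fun m → Fun m → Fun m
  (f ∨ᶠ g) x = f x ∨ g x

  _∧ᶠ_ : Fun m → Fun m → Fun m
  (f ∧ᶠ g) x = f x ∧ g x

  ∨ᶠ-upperˡ : (f g : Fun m) → f ⇒ᶠ f ∨ᶠ g
  ∨ᶠ-upperˡ f g x fx rewrite fx = refl

  ∨ᶠ-upperʳ : (f g : Fun m) → g ⇒ᶠ f ∨ᶠ g
  ∨ᶠ-upperʳ f g x gx rewrite gx = ∨-zeroʳ (f x)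

  ∨ᶠ-least : {f g h : Fun m} → f ⇒ᶠ h → g ⇒ᶠ h → f ∨ᶠ g ⇒ᶠ h
  ∨ᶠ-least {f} f⇒h g⇒h x f∨gx with f x in fx
  ... | true  = f⇒h x fx
  ... | false = g⇒h x f∨gx

  ∨ᶠ-strict : {f g : Fun m} → ¬ g ⇒ᶠ f → f <ᶠ f ∨ᶠ g
  ∨ᶠ-strict {f} {g} g⇏f = ∨ᶠ-upperˡ f g , λ f≗f∨g → g⇏f λ x gx → trans (f≗f∨g x) (∨ᶠ-upperʳ f g x gx)

  ∣_∣ᶠ : Fun m → ℕ
  ∣ f ∣ᶠ = ∣ tabulate f ∣

  ∣∣ᶠ-cong : {f g : Fun m} → f ≗ g → ∣ f ∣ᶠ ≡ ∣ g ∣ᶠ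
  ∣∣ᶠ-cong f≗g = cong ∣_∣ (tabulate-cong f≗g)

  ∣f∣ᶠ≤m : (f : Fun m) → ∣ f ∣ᶠ ≤ m
  ∣f∣ᶠ≤m f = ∣p∣≤n (tabulate f)

  ∈tabulate⁺ : (f : Fun m) {x : Fin m} → f x ≡ true → x ∈ tabulate f
  ∈tabulate⁺ f {x} fx = lookup⇒[]= x (tabulate f) (trans (lookup∘tabulate f x) fx)

  ∈tabulate⁻ : (f : Fun m) {x : Fin m} → x ∈ tabulate f → f x ≡ true
  ∈tabulate⁻ f {x} x∈f = trans (sym (lookup∘tabulate f x)) ([]=⇒lookup x∈f)

  <ᶠ⇒∣∣ᶠ< : {f g : Fun m} → f <ᶠ g → ∣ f ∣ᶠ < ∣ g ∣ᶠ
  <ᶠ⇒∣∣ᶠ< {f} {g} f<g with <ᶠ⇒∃-gap f<g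
  ... | x , fx , gx = p⊂q⇒∣p∣<∣q∣
    ( (λ y∈f → ∈tabulate⁺ g (proj₁ f<g _ (∈tabulate⁻ f y∈f)))
    , x , ∈tabulate⁺ g gx , λ x∈f → contradiction (trans (sym fx) (∈tabulate⁻ f x∈f)) λ ())

-- Teaching sets in an arbitrary class

module _ {m : ℕ} {C : Class m} where

  witness⇒specifying : ∀ {G W} → IsWitnessSet C G W → IsSpecifyingSet C G W
  witness⇒specifying {G} {W} witness g₁ g₂ g₁∈ g₂∈ g₁≈G g₂≈G = ≗-trans (≗-sym (agrees⇒≗ g₁∈ g₁≈G)) (agrees⇒≗ g₂∈ g₂≈G)
    where
    agrees⇒≗ : ∀ {g} → C g → (∀ x → x ∈ W → g x ≡ G x) → G ≗ g
    agrees⇒≗ {g} g∈ g≈G with G ≗? g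
    ... | yes G≗g = G≗g
    ... | no G≉g with witness g g∈ G≉g
    ...   | x , x∈W , Gx≢gx = contradiction (sym (g≈G x x∈W)) Gx≢gx

  specifying⇒witness : ∀ {G W} → C G → IsSpecifyingSet C G W → IsWitnessSet C G W
  specifying⇒witness {G} {W} G∈ specifying G′ G′∈ G≉G′ with any? (λ x → (x ∈? W) ×-dec ¬? (G x ≟ᵇ G′ x))
  ... | yes separated = separated
  ... | no ¬separated = contradiction (specifying G G′ G∈ G′∈ (λ _ _ → refl) G′≈G) G≉G′
    where
    G′≈G : ∀ x → x ∈ W → G′ x ≡ G x
    G′≈G x x∈W = sym (decidable-stable (G x ≟ᵇ G′ x) λ Gx≢G′x → ¬separated (x , x∈W , Gx≢G′x))

  witness-resp-≗ : ∀ {G G′ W} → G ≗ G′ → IsWitnessSet C G W → IsWitnessSet C G′ W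
  witness-resp-≗ G≗G′ witness g g∈ G′≉g with witness g g∈ (G′≉g ∘ ≗-trans (≗-sym G≗G′))
  ... | x , x∈W , Gx≢gx = x , x∈W , Gx≢gx ∘ trans (G≗G′ x)

  ⊤-witness : ∀ {G} → IsWitnessSet C G ⊤
  ⊤-witness G′ _ G≉G′ with ≉⇒∃≢ G≉G′
  ... | x , Gx≢G′x = x , ∈⊤ , Gx≢G′x

  TDat≤m : ∀ {G n} → TDat C G n → n ≤ m
  TDat≤m {n = n} (_ , minimal) = subst (n ≤_) (∣⊤∣≡n m) (minimal ⊤ ⊤-witness)

HasSize-insert : ∀ {m} {P : Class m} {f n} → P f → HasSize (λ g → P g × ¬ g ≗ f) n → HasSize P (suc n)
HasSize-insert {P = P} {f} f∈P (v , v∈ , v-injective , v-onto) = f Vector.∷ v , ∈P , injective , onto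
  where
  ∈P : ∀ i → P ((f Vector.∷ v) i)
  ∈P zero    = f∈P
  ∈P (suc i) = proj₁ (v∈ i)

  injective : ∀ i j → (f Vector.∷ v) i ≗ (f Vector.∷ v) j → i ≡ j
  injective zero    zero    _     = refl
  injective zero    (suc j) f≗vj  = contradiction (≗-sym f≗vj) (proj₂ (v∈ j))
  injective (suc i) zero    vi≗f  = contradiction vi≗f (proj₂ (v∈ i))
  injective (suc i) (suc j) vi≗vj = cong suc (v-injective i j vi≗vj)

  onto : ∀ g → P g → ∃ λ i → g ≗ (f Vector.∷ v) i
  onto g g∈P with g ≗? f
  ... | yes g≗f = zero , g≗f
  ... | no g≉f  = let i , g≗vi = v-onto g (g∈P , g≉f) in suc i , g≗vi

hasSize : ∀ {m} {P : Class m} → Decidable P → (∀ {f g} → f ≗ g → P f → P g) →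
          (L : List (Fun m)) → (∀ {g} → P g → Any (g ≗_) L) → ∃ (HasSize P)
hasSize P? P-resp List.[] covered = 0 , (λ ()) , (λ ()) , (λ ()) , λ g g∈P → contradiction (covered g∈P) λ ()
hasSize P? P-resp (f List.∷ L) covered with P? f
... | no f∉P = hasSize P? P-resp L λ g∈P → Any.tail (λ g≗f → f∉P (P-resp g≗f g∈P)) (covered g∈P)
... | yes f∈P =
  let n , size = hasSize (λ g → P? g ×-dec ¬? (g ≗? f))
                         (λ g≗g′ (g∈P , g≉f) → P-resp g≗g′ g∈P , g≉f ∘ ≗-trans g≗g′)
                         L (λ (g∈P , g≉f) → Any.tail g≉f (covered g∈P))
  in suc n , HasSize-insert f∈P size

-- The disjunctive closure F∨

allSubsets : ∀ n → List (Subset n)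
allSubsets zero    = List.[ [] ]
allSubsets (suc n) = List.map (true ∷_) (allSubsets n) ++ List.map (false ∷_) (allSubsets n)

∈allSubsets : ∀ {n} (S : Subset n) → S ∈ˡ allSubsets n
∈allSubsets []      = here refl
∈allSubsets (true ∷ S)  = ∈-++⁺ˡ (∈-map⁺ (true ∷_) (∈allSubsets S))
∈allSubsets {suc n} (false ∷ S) = ∈-++⁺ʳ (List.map (true ∷_) (allSubsets n)) (∈-map⁺ (false ∷_) (∈allSubsets S))

bigOr-∪ : ∀ {m k} (fs : Fin k → Fun m) (S T : Subset k) x → bigOr fs (S ∪ T) x ≡ bigOr fs S x ∨ bigOr fs T x
bigOr-∪ fs []      []      x = refl
bigOr-∪ fs (b ∷ S) (c ∷ T) x = begin
  ((b ∨ c) ∧ f) ∨ bigOr (fs ∘ suc) (S ∪ T) x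
    ≡⟨ cong₂ _∨_ (∧-distribʳ-∨ f b c) (bigOr-∪ (fs ∘ suc) S T x) ⟩
  ((b ∧ f) ∨ (c ∧ f)) ∨ (bigOr (fs ∘ suc) S x ∨ bigOr (fs ∘ suc) T x)
    ≡⟨ interchange (b ∧ f) (c ∧ f) _ _ ⟩
  ((b ∧ f) ∨ bigOr (fs ∘ suc) S x) ∨ ((c ∧ f) ∨ bigOr (fs ∘ suc) T x)
    ∎
  where
  open ≡-Reasoning
  f = fs zero x

module _ {m k : ℕ} (fs : Fin k → Fun m) where

  private
    F∨ : Class m
    F∨ = OrClosure fs

  top : Fun m
  top = bigOr fs ⊤

  bigOr∈F∨ : ∀ S → F∨ (bigOr fs S)
  bigOr∈F∨ S = S , λ _ → refl

  F∨-resp-≗ : ∀ {f g} → f ≗ g → F∨ f → F∨ g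
  F∨-resp-≗ f≗g (S , f≗S) = S , ≗-trans (≗-sym f≗g) f≗S

  ∨ᶠ-closed : ∀ {f g} → F∨ f → F∨ g → F∨ (f ∨ᶠ g)
  ∨ᶠ-closed (S , f≗S) (T , g≗T) = S ∪ T , λ x → trans (cong₂ _∨_ (f≗S x) (g≗T x)) (sym (bigOr-∪ fs S T x))

  ⇒top : ∀ {f} → F∨ f → f ⇒ᶠ top
  ⇒top (S , f≗S) x fx = begin
    bigOr fs ⊤ x                    ≡⟨ cong (λ T → bigOr fs T x) (sym (∪-zeroʳ S)) ⟩
    bigOr fs (S ∪ ⊤) x              ≡⟨ bigOr-∪ fs S ⊤ x ⟩
    bigOr fs S x ∨ bigOr fs ⊤ x     ≡⟨ cong (_∨ bigOr fs ⊤ x) (trans (sym (f≗S x)) fx) ⟩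
    true                            ∎
    where open ≡-Reasoning

  F∨? : Decidable F∨
  F∨? f = anySubset? λ S → f ≗? bigOr fs S

  ∃F∨? : {Q : Class m} → Decidable Q → (∀ {f g} → f ≗ g → Q f → Q g) → Dec (∃ λ K → F∨ K × Q K)
  ∃F∨? Q? Q-resp with anySubset? (Q? ∘ bigOr fs)
  ... | yes (S , qS) = yes (bigOr fs S , bigOr∈F∨ S , qS)
  ... | no ∄        = no λ (K , (S , K≗S) , qK) → ∄ (S , Q-resp K≗S qK)

  F∨-listed : ∀ {f} → F∨ f → Any (f ≗_) (List.map (bigOr fs) (allSubsets k))
  F∨-listed (S , f≗S) = Any.map (λ { refl → f≗S }) (∈-map⁺ (bigOr fs) (∈allSubsets S))

  Minimal : Class m → Class m
  Minimal Q M = F∨ M × Q M × (∀ {K} → F∨ K → Q K → ¬ K <ᶠ M)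

  Maximal : Class m → Class m
  Maximal Q M = F∨ M × Q M × (∀ {K} → F∨ K → Q K → ¬ M <ᶠ K)

  module _ {Q : Class m} (Q? : Decidable Q) (Q-resp : ∀ {f g} → f ≗ g → Q f → Q g) where

    minimal : ∀ {K} → F∨ K → Q K → ∃ (Minimal Q)
    minimal (S₀ , K≗S₀) qK with argmin (Q? ∘ bigOr fs) (∣_∣ᶠ ∘ bigOr fs) (S₀ , Q-resp K≗S₀ qK)
    ... | S , qS , lightest = bigOr fs S , bigOr∈F∨ S , qS , λ (T , K≗T) qK K<S →
      <⇒≱ (<ᶠ⇒∣∣ᶠ< K<S) (subst (_ ≤_) (sym (∣∣ᶠ-cong K≗T)) (lightest {T} (Q-resp K≗T qK)))

    maximal : ∀ {K} → F∨ K → Q K → ∃ (Maximal Q)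
    maximal (S₀ , K≗S₀) qK with argmax (Q? ∘ bigOr fs) (∣_∣ᶠ ∘ bigOr fs) (∣f∣ᶠ≤m ∘ bigOr fs) (S₀ , Q-resp K≗S₀ qK)
    ... | S , qS , heaviest = bigOr fs S , bigOr∈F∨ S , qS , λ (T , K≗T) qK S<K →
      <⇒≱ (<ᶠ⇒∣∣ᶠ< S<K) (subst (_≤ _) (sym (∣∣ᶠ-cong K≗T)) (heaviest {T} (Q-resp K≗T qK)))

  immAsc-below : ∀ {G K} → F∨ K → G <ᶠ K → ∃ λ s → ImmAsc F∨ G s × s ⇒ᶠ K
  immAsc-below {G} {K} K∈ G<K
    with minimal {λ s → G <ᶠ s × s ⇒ᶠ K} (λ s → (G <ᶠ? s) ×-dec (s ⇒ᶠ? K))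
                 (λ f≗g (G<f , f⇒K) → <ᶠ-resp-≗ (λ _ → refl) f≗g G<f , ⇒ᶠ-resp-≗ f≗g (λ _ → refl) f⇒K)
                 K∈ (G<K , λ _ Kx → Kx)
  ... | s , s∈ , (G<s , s⇒K) , lowest =
    s , (s∈ , G<s , λ (K′ , K′∈ , G<K′ , K′<s) → lowest K′∈ (G<K′ , ⇒ᶠ-trans (proj₁ K′<s) s⇒K) K′<s) , s⇒K

  immDesc-above : ∀ {G H} → F∨ H → H <ᶠ G → ∃ λ D → ImmDesc F∨ G D × H ⇒ᶠ D
  immDesc-above {G} {H} H∈ H<G
    with maximal {λ D → H ⇒ᶠ D × D <ᶠ G} (λ D → (H ⇒ᶠ? D) ×-dec (D <ᶠ? G))
                 (λ f≗g (H⇒f , f<G) → ⇒ᶠ-resp-≗ (λ _ → refl) f≗g H⇒f , <ᶠ-resp-≗ f≗g (λ _ → refl) f<G)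
                 H∈ ((λ _ Hx → Hx) , H<G)
  ... | D , D∈ , (H⇒D , D<G) , highest =
    D , (D∈ , D<G , λ (K , K∈ , D<K , K<G) → highest K∈ (⇒ᶠ-trans H⇒D (proj₁ D<K) , K<G) D<K) , H⇒D

  immAsc-gap : ∀ {G s} → ImmAsc F∨ G s → ∃ λ x → (s x ∧ not (G x)) ≡ true
  immAsc-gap (_ , G<s , _) with <ᶠ⇒∃-gap G<s
  ... | x , Gx , sx = x , cong₂ (λ a b → a ∧ not b) sx Gx

  immDesc-∨ᶠ≗ : ∀ {G D₁ D₂} → ImmDesc F∨ G D₁ → ImmDesc F∨ G D₂ → ¬ D₁ ≗ D₂ → D₁ ∨ᶠ D₂ ≗ G
  immDesc-∨ᶠ≗ {G} {D₁} {D₂} (D₁∈ , D₁<G , D₁-imm) (D₂∈ , D₂<G , D₂-imm) D₁≉D₂ with D₂ ⇒ᶠ? D₁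
  ... | yes D₂⇒D₁ = contradiction (D₁ , D₁∈ , (D₂⇒D₁ , D₁≉D₂ ∘ ≗-sym) , D₁<G) D₂-imm
  ... | no D₂⇏D₁ with D₁ ∨ᶠ D₂ ≗? G
  ...   | yes ∨≗G = ∨≗G
  ...   | no ∨≉G  = contradiction
          (D₁ ∨ᶠ D₂ , ∨ᶠ-closed D₁∈ D₂∈ , ∨ᶠ-strict D₂⇏D₁ , ∨ᶠ-least (proj₁ D₁<G) (proj₁ D₂<G) , ∨≉G) D₁-imm

  immDesc-unique-at : ∀ {G D₁ D₂ x} → ImmDesc F∨ G D₁ → ImmDesc F∨ G D₂ →
                      G x ≡ true → D₁ x ≡ false → D₂ x ≡ false → D₁ ≗ D₂
  immDesc-unique-at {G} {D₁} {D₂} {x} D₁-desc D₂-desc Gx D₁x D₂x with D₁ ≗? D₂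
  ... | yes D₁≗D₂ = D₁≗D₂
  ... | no D₁≉D₂  = contradiction
          (trans (sym (cong₂ _∨_ D₁x D₂x)) (trans (immDesc-∨ᶠ≗ D₁-desc D₂-desc D₁≉D₂ x) Gx)) λ ()

  between-resp-≗ : {f g K K′ : Fun m} → K ≗ K′ → f <ᶠ K × K <ᶠ g → f <ᶠ K′ × K′ <ᶠ g
  between-resp-≗ K≗K′ (f<K , K<g) = <ᶠ-resp-≗ (λ _ → refl) K≗K′ f<K , <ᶠ-resp-≗ K≗K′ (λ _ → refl) K<g

  ImmDesc? : ∀ G → Decidable (ImmDesc F∨ G)
  ImmDesc? G H = F∨? H ×-dec (H <ᶠ? G) ×-dec ¬? (∃F∨? (λ K → (H <ᶠ? K) ×-dec (K <ᶠ? G)) between-resp-≗)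

  ImmAsc? : ∀ G → Decidable (ImmAsc F∨ G)
  ImmAsc? G H = F∨? H ×-dec (G <ᶠ? H) ×-dec ¬? (∃F∨? (λ K → (G <ᶠ? K) ×-dec (K <ᶠ? H)) between-resp-≗)

  ImmDesc-resp-≗ : ∀ {G H H′} → H ≗ H′ → ImmDesc F∨ G H → ImmDesc F∨ G H′
  ImmDesc-resp-≗ H≗H′ (H∈ , H<G , H-imm) =
    F∨-resp-≗ H≗H′ H∈ , <ᶠ-resp-≗ H≗H′ (λ _ → refl) H<G ,
    λ (K , K∈ , H′<K , K<G) → H-imm (K , K∈ , <ᶠ-resp-≗ (≗-sym H≗H′) (λ _ → refl) H′<K , K<G)

  ImmAsc-resp-≗ : ∀ {G H H′} → H ≗ H′ → ImmAsc F∨ G H → ImmAsc F∨ G H′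
  ImmAsc-resp-≗ H≗H′ (H∈ , G<H , H-imm) =
    F∨-resp-≗ H≗H′ H∈ , <ᶠ-resp-≗ (λ _ → refl) H≗H′ G<H ,
    λ (K , K∈ , G<K , K<H′) → H-imm (K , K∈ , G<K , <ᶠ-resp-≗ (λ _ → refl) (≗-sym H≗H′) K<H′)

  hits? : (W : Subset m) (G s : Fun m) → Dec (∃ λ x → x ∈ W × (s x ∧ not (G x)) ≡ true)
  hits? W G s = any? λ x → (x ∈? W) ×-dec ((s x ∧ not (G x)) ≟ᵇ true)

  -- The nonzero hypothesis of IsHittingSet holds automatically (immAsc-gap), and every immediate
  -- ascendant is some bigOr fs S, so only the 2^k subsets S need checking.
  hitting? : ∀ G → Decidable (IsHittingSet (AscAndNotG F∨ G))
  hitting? G W with anySubset? (λ S → ImmAsc? G (bigOr fs S) ×-dec ¬? (hits? W G (bigOr fs S)))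
  ... | yes (S , S-asc , missed) =
    no λ hitting → missed (hitting _ (bigOr fs S , S-asc , λ _ → refl) (immAsc-gap S-asc))
  ... | no ∄missed = yes λ { g (s , s-asc@((S , s≗S) , _) , g≗) _ →
    let x , x∈W , hit = decidable-stable (hits? W G (bigOr fs S))
                          (λ missed → ∄missed (S , ImmAsc-resp-≗ s≗S s-asc , missed))
    in x , x∈W , trans (g≗ x) (trans (cong (λ b → b ∧ not (G x)) (s≗S x)) hit) }

  -- Opaque: these sizes come from exhaustive search, and unfolding them during type checking is ruinous.
  opaque
    immDesc-size : ∀ G → ∃ (HasSize (ImmDesc F∨ G))
    immDesc-size G = hasSize (ImmDesc? G) ImmDesc-resp-≗ (List.map (bigOr fs) (allSubsets k)) (F∨-listed ∘ proj₁)

    hs-size : ∀ G → ∃ (HS (AscAndNotG F∨ G))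
    hs-size G = minSize (hitting? G) (⊤ , λ g _ (x , gx) → x , ∈⊤ , gx)

  witnessSet-size : ∀ {G W d e} → HasSize (ImmDesc F∨ G) d → HS (AscAndNotG F∨ G) e →
                    IsWitnessSet F∨ G W → d + e ≤ ∣ W ∣
  witnessSet-size {G} {W} {d} {e} (v , v-desc , v-injective , _) (_ , hs-minimal) witness = begin
    d + e                                        ≤⟨ +-mono-≤ d≤ e≤ ⟩
    ∣ W ∩ tabulate G ∣ + ∣ W ∩ ∁ (tabulate G) ∣  ≡⟨ ∣p∩q∣+∣p∩∁q∣≡∣p∣ W (tabulate G) ⟩
    ∣ W ∣                                        ∎
    where
    open ≤-Reasoning

    separating : ∀ i → ∃ λ x → x ∈ W × v i x ≡ false × G x ≡ true
    separating i with v-desc i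
    ... | vi∈ , (vi⇒G , vi≉G) , _ with witness (v i) vi∈ (vi≉G ∘ ≗-sym)
    ...   | x , x∈W , Gx≢vix = x , x∈W , ⇒ᶠ-separates vi⇒G (Gx≢vix ∘ sym)

    a : Fin d → Fin m
    a i = proj₁ (separating i)

    a-injective : Injective _≡_ _≡_ a
    a-injective {i} {j} aᵢ≡aⱼ =
      let _ , _ , vᵢaᵢ , Gaᵢ = separating i
          _ , _ , vⱼaⱼ , _   = separating j
      in v-injective i j (immDesc-unique-at (v-desc i) (v-desc j) Gaᵢ vᵢaᵢ (subst (λ y → v j y ≡ false) (sym aᵢ≡aⱼ) vⱼaⱼ))

    d≤ : d ≤ ∣ W ∩ tabulate G ∣
    d≤ = injective⇒≤∣p∣ (W ∩ tabulate G) a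
           (λ i → let _ , x∈W , _ , Gx = separating i in x∈p∩q⁺ (x∈W , ∈tabulate⁺ G Gx)) a-injective

    hitting : IsHittingSet (AscAndNotG F∨ G) (W ∩ ∁ (tabulate G))
    hitting g (s , (s∈ , (G⇒s , G≉s) , _) , g≗) _ with witness s s∈ G≉s
    ... | x , x∈W , Gx≢sx with ⇒ᶠ-separates G⇒s Gx≢sx
    ...   | Gx , sx = x , x∈p∩q⁺ (x∈W , x∉p⇒x∈∁p λ x∈G → contradiction (trans (sym Gx) (∈tabulate⁻ G x∈G)) λ ())
                    , trans (g≗ x) (cong₂ (λ a b → a ∧ not b) sx Gx)

    e≤ : e ≤ ∣ W ∩ ∁ (tabulate G) ∣
    e≤ = hs-minimal _ hitting

  specifyingSet : ∀ {h M d e} → Minimal ((h ∧ᶠ top) ⇒ᶠ_) M → HasSize (ImmDesc F∨ M) d → HS (AscAndNotG F∨ M) e →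
                  ∃ λ S → IsSpecifyingSet F∨ h S × ∣ S ∣ ≤ d + e
  specifyingSet {h} {M} {d} {e} (M∈ , h⇒M , lowest) (v , v-desc , _ , v-onto) ((Q , Q-hitting , ∣Q∣≡e) , _) =
    image b ∪ Q ,
    (λ g₁ g₂ g₁∈ g₂∈ g₁≈h g₂≈h → ≗-trans (agrees⇒≗M g₁∈ g₁≈h) (≗-sym (agrees⇒≗M g₂∈ g₂≈h))) ,
    ≤-trans (∣p∪q∣≤∣p∣+∣q∣ (image b) Q) (+-mono-≤ (∣image∣≤ b) (≤-reflexive ∣Q∣≡e))
    where
    gap : ∀ i → ∃ λ x → (h ∧ᶠ top) x ≡ true × v i x ≡ false
    gap i = ⇏ᶠ⇒∃-gap λ h⇒vi → lowest (proj₁ (v-desc i)) h⇒vi (proj₁ (proj₂ (v-desc i)))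

    b : Fin d → Fin m
    b i = proj₁ (gap i)

    Agrees : Fun m → Set
    Agrees g = ∀ x → x ∈ image b ∪ Q → g x ≡ h x

    -- Such a g would lie below an immediate descendant vᵢ, but g (b i) = h (b i) = 1 and vᵢ (b i) = 0.
    agrees⇒≮M : ∀ {g} → F∨ g → Agrees g → ¬ g <ᶠ M
    agrees⇒≮M {g} g∈ g≈h g<M with immDesc-above g∈ g<M
    ... | D , D-desc , g⇒D with v-onto D D-desc
    ...   | i , D≗vᵢ = contradiction (trans (sym vᵢx) (trans (sym (D≗vᵢ x)) (g⇒D x gx))) λ ()
      where
      x = b i
      vᵢx = proj₂ (proj₂ (gap i))
      gx : g x ≡ true
      gx = trans (g≈h x (x∈p∪q⁺ (inj₁ (a∈image b i)))) (∧-conicalˡ (h x) (top x) (proj₁ (proj₂ (gap i))))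

    -- Otherwise an immediate ascendant s ⇒ M ∨ g of M is hit by Q at some x with s x = 1 and M x = 0;
    -- then g x = h x = 1 and top x = 1, so M x = 1 after all.
    agrees⇒⇒M : ∀ {g} → F∨ g → Agrees g → g ⇒ᶠ M
    agrees⇒⇒M {g} g∈ g≈h = decidable-stable (g ⇒ᶠ? M) λ g⇏M →
      let s , s-asc , s⇒M∨g = immAsc-below (∨ᶠ-closed M∈ g∈) (∨ᶠ-strict g⇏M)
          x , x∈Q , sx∧¬Mx  = Q-hitting _ (s , s-asc , λ _ → refl) (immAsc-gap s-asc)
          sx = ∧-conicalˡ (s x) _ sx∧¬Mx
          Mx = not-injective (∧-conicalʳ (s x) _ sx∧¬Mx)
          gx = trans (sym (cong (_∨ g x) Mx)) (s⇒M∨g x sx)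
          hx = trans (sym (g≈h x (x∈p∪q⁺ (inj₂ x∈Q)))) gx
      in contradiction (trans (sym Mx) (h⇒M x (cong₂ _∧_ hx (⇒top (proj₁ s-asc) x sx)))) λ ()

    agrees⇒≗M : ∀ {g} → F∨ g → Agrees g → g ≗ M
    agrees⇒≗M {g} g∈ g≈h = decidable-stable (g ≗? M) λ g≉M → agrees⇒≮M g∈ g≈h (agrees⇒⇒M g∈ g≈h , g≉M)

  minimal-self : ∀ {G} → F∨ G → Minimal ((G ∧ᶠ top) ⇒ᶠ_) G
  minimal-self {G} G∈ =
    G∈ , (λ x Gx∧topx → ∧-conicalˡ (G x) (top x) Gx∧topx) ,
    λ K∈ G∧top⇒K (K⇒G , K≉G) → K≉G (⇒ᶠ-antisym K⇒G λ x Gx → G∧top⇒K x (cong₂ _∧_ Gx (⇒top G∈ x Gx)))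

  minimal-above : ∀ h → ∃ (Minimal ((h ∧ᶠ top) ⇒ᶠ_))
  minimal-above h = minimal (λ M → (h ∧ᶠ top) ⇒ᶠ? M) (⇒ᶠ-resp-≗ (λ _ → refl)) (bigOr∈F∨ ⊤)
                      (λ x hx∧topx → ∧-conicalʳ (h x) (top x) hx∧topx)

  TDat-deHS : ∀ {G d e} → F∨ G → HasSize (ImmDesc F∨ G) d → HS (AscAndNotG F∨ G) e → TDat F∨ G (d + e)
  TDat-deHS G∈ desc hs =
    let S , specifying , ∣S∣≤ = specifyingSet (minimal-self G∈) desc hs
        witness               = specifying⇒witness G∈ specifying
    in (S , witness , ≤-antisym ∣S∣≤ (witnessSet-size desc hs witness)) , λ _ → witnessSet-size desc hs

  deHS : Fun m → ℕ
  deHS G = proj₁ (immDesc-size G) + proj₁ (hs-size G)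

  TDat-of : ∀ {G} → F∨ G → TDat F∨ G (deHS G)
  TDat-of G∈ = TDat-deHS G∈ (proj₂ (immDesc-size _)) (proj₂ (hs-size _))

  TDat-unique : ∀ {G S j} → G ≗ bigOr fs S → TDat F∨ G j → j ≡ deHS (bigOr fs S)
  TDat-unique {S = S} G≗S tdj =
    IsMinSize-unique (IsMinSize-cong (witness-resp-≗ G≗S) (witness-resp-≗ (≗-sym G≗S)) tdj) (TDat-of (bigOr∈F∨ S))

  deHS-argmax : ∃ λ S → U S × (∀ {T} → U T → deHS (bigOr fs T) ≤ deHS (bigOr fs S))
  deHS-argmax = argmax U? (deHS ∘ bigOr fs) (λ S → TDat≤m (TDat-of (bigOr∈F∨ S))) (⊤ , _)

  Sₘₐₓ : Subset k
  Sₘₐₓ = proj₁ deHS-argmax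

  tdₘₐₓ : ℕ
  tdₘₐₓ = deHS (bigOr fs Sₘₐₓ)

  TDat≤tdₘₐₓ : ∀ {G j} → F∨ G → TDat F∨ G j → j ≤ tdₘₐₓ
  TDat≤tdₘₐₓ (S , G≗S) tdj = subst (_≤ tdₘₐₓ) (sym (TDat-unique {S = S} G≗S tdj))
    (proj₂ (proj₂ deHS-argmax) {S} _)

  TD-tdₘₐₓ : TD F∨ tdₘₐₓ
  TD-tdₘₐₓ = (bigOr fs Sₘₐₓ , bigOr∈F∨ Sₘₐₓ , TDat-of (bigOr∈F∨ Sₘₐₓ)) , λ _ _ → TDat≤tdₘₐₓ

  MaxDeHS-tdₘₐₓ : MaxDeHS F∨ tdₘₐₓ
  MaxDeHS-tdₘₐₓ =
    (bigOr fs Sₘₐₓ , bigOr∈F∨ Sₘₐₓ , _ , _ , proj₂ (immDesc-size _) , proj₂ (hs-size _) , refl) ,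
    λ { G _ G∈ (_ , _ , desc , hs , refl) → TDat≤tdₘₐₓ G∈ (TDat-deHS G∈ desc hs) }

  ETDat≤tdₘₐₓ : ∀ {h j} → ETDat F∨ h j → j ≤ tdₘₐₓ
  ETDat≤tdₘₐₓ {h} (_ , shortest) =
    let M , M-min@(M∈ , _)        = minimal-above h
        S , specifying , ∣S∣≤deHS = specifyingSet M-min (proj₂ (immDesc-size M)) (proj₂ (hs-size M))
    in ≤-trans (shortest S specifying) (≤-trans ∣S∣≤deHS (TDat≤tdₘₐₓ M∈ (TDat-of M∈)))

  ETD-tdₘₐₓ : ETD F∨ tdₘₐₓ
  ETD-tdₘₐₓ =
    (bigOr fs Sₘₐₓ , IsMinSize-cong witness⇒specifying (specifying⇒witness (bigOr∈F∨ Sₘₐₓ)) (TDat-of (bigOr∈F∨ Sₘₐₓ))) ,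
    λ _ _ → ETDat≤tdₘₐₓ

lemma14 : ∀ {m k} (fs : Fin k → Fun m) →
    ((G : Fun m) → OrClosure fs G →
      Σ ℕ λ d → Σ ℕ λ h → Σ ℕ λ t →
        HasSize (ImmDesc (OrClosure fs) G) d ×
        HS (AscAndNotG (OrClosure fs) G) h ×
        TDat (OrClosure fs) G t ×
        d + h ≤ t)
    ×
    (Σ ℕ λ n → ETD (OrClosure fs) n × TD (OrClosure fs) n × MaxDeHS (OrClosure fs) n)
lemma14 fs =
  (λ G G∈ → let d , desc = immDesc-size fs G
                e , hs   = hs-size fs G
            in d , e , d + e , desc , hs , TDat-deHS fs G∈ desc hs , ≤-refl) ,
  tdₘₐₓ fs , ETD-tdₘₐₓ fs , TD-tdₘₐₓ fs , MaxDeHS-tdₘₐₓ fs
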